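{- For any sequence of $t$ updates, the running time of the data structure is deterministically at most $O(tn^2+n\log n+\Delta n)$.
   Context: Setting: $G=(V,E)$ is a dynamic graph on a fixed set $V$ of $n$ vertices that starts with no edges and undergoes a sequence of $t$ updates, each the insertion or deletion of one edge. A fixed integer $\Delta>0$ upper-bounds the maximum degree of $G$ at all times, and $\mathcal{C}=\{1,\dots,\Delta+1\}$ is the set of colors. Let $L=\lceil\log_3(n-1)\rceil-1$. The data structure maintains a coloring $\chi:V\to\mathcal{C}$ and a level $\ell(v)\in\{ -1,0,\dots,L\}$ for each vertex $v$. For an edge $uv$, $u$ is an up-neighbor of $v$ if $\ell(u)\ge\ell(v)$ and a down-neighbor of $v$ if $\ell(u)<\ell(v)$. For a level $k$, $\phi_v(k)$ is the number of neighbors $u$ of $v$ with $\ell(u)<k$. A color $c$ is blank for $v$ if no neighbor of $v$ has color $c$, and unique for $v$ if no up-neighbor of $v$ has color $c$ and exactly one down-neighbor of $v$ has color $c$. Algorithm: initially every vertex is at level $-1$ with an arbitrary color. A deletion changes nothing. On insertion of an edge $uv$: if $\chi(u)\neq\chi(v)$ nothing changes; otherwise let $x$ be the endpoint among $u,v$ that was recolored most recently, and repeat $x\leftarrow\texttt{recolor}(x)$ until $x=\mathrm{NULL}$. The procedure $\texttt{recolor}(x)$: if $\phi_x(\ell(x)+1)<3^{\ell(x)+2}$, call $\texttt{det-color}(x)$, which assigns to $x$ a deterministically chosen blank color, sets $\ell(x)=-1$, and then return NULL. Otherwise call $\texttt{rand-color}(x)$, which: lets $\ell'$ be the minimum level $\ell'>\ell(x)$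 with $\phi_x(\ell'+1)<3^{\ell'+2}$ and sets $\ell(x)=\ell'$; picks uniformly at random a color $c$ among the colors that are blank or unique for $x$ and sets $\chi(x)=c$; returns NULL if $c$ is blank for $x$, and otherwise returns the unique down-neighbor $y$ of $x$ with $\chi(y)=c$. The data structure implements this algorithm with preprocessing time $O(n\log n+\Delta n)$, $O(1)$ deterministic time per deletion and per insertion with $\chi(u)\ne\chi(v)$, time $O(3^{\ell(x)})$ per call $\texttt{det-color}(x)$ ($\ell(x)$ the level at the start of the call) and time $O(3^{\ell'})$ per call $\texttt{rand-color}(x)$ ($\ell'$ the new level). Running time includes preprocessing. -}

module Defs where

open import Data.Nat using (ℕ; zero; suc; _+_; _*_; _^_; _≤_; _<_; _<ᵇ_; _≤ᵇ_)
open import Data.Nat.Logarithm using (⌈log₂_⌉)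
open import Data.Bool using (Bool; true; false; _∧_; _∨_; not; T)
open import Data.Fin using (Fin)
import Data.Fin as Fin
open import Data.List using (List; []; _∷_; length; filterᵇ; allFin)
open import Data.Maybe using (Maybe; just; nothing)
open import Data.Product using (_×_; _,_; Σ; ∃-syntax)
open import Data.Sum using (_⊎_)
open import Relation.Nullary using (¬_)
open import Relation.Nullary.Decidable using (⌊_⌋)
open import Relation.Binary.PropositionalEquality using (_≡_; _≢_)
open import Relation.Binary.Construct.Closure.ReflexiveTransitive using (Star)

_==_ : ∀ {n} → Fin n → Fin n → Bool
a == b = ⌊ a Fin.≟ b ⌋

count : ∀ {n} → (Fin n → Bool) → ℕ
count {n} p = length (filterᵇ p (allFin n))

update : ∀ {n} {A : Set} → (Fin n → A) → Fin n → A → Fin n → A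
update f x a y = if (y == x) then a else f y
  where open import Data.Bool using (if_then_else_)

Adj : ℕ → Set
Adj n = Fin n → Fin n → Bool

emptyG : ∀ {n} → Adj n
emptyG _ _ = false

addEdge : ∀ {n} → Adj n → Fin n → Fin n → Adj n
addEdge g u v a b = g a b ∨ ((a == u ∧ b == v) ∨ (a == v ∧ b == u))

delEdge : ∀ {n} → Adj n → Fin n → Fin n → Adj n
delEdge g u v a b = g a b ∧ not ((a == u ∧ b == v) ∨ (a == v ∧ b == u))

degree : ∀ {n} → Adj n → Fin n → ℕ
degree g w = count (g w)

MaxDegLe : ∀ {n} → ℕ → Adj n → Set
MaxDegLe Δ g = ∀ w → degree g w ≤ Δ

data Update (n : ℕ) : Set where
  ins : Fin n → Fin n → Update n
  del : Fin n → Fin n → Update n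

data Valid {n : ℕ} (Δ : ℕ) : Adj n → List (Update n) → Set where
  v-nil : ∀ {g} → Valid Δ g []
  v-ins : ∀ {g u v us} → u ≢ v → g u v ≡ false →
          MaxDegLe Δ (addEdge g u v) →
          Valid Δ (addEdge g u v) us → Valid Δ g (ins u v ∷ us)
  v-del : ∀ {g u v us} → g u v ≡ true →
          Valid Δ (delEdge g u v) us → Valid Δ g (del u v ∷ us)

-- Configurations of the data structure.
-- LEVEL CONVENTION: lev v = ℓ(v) + 1 ∈ ℕ, so paper level -1 is stored as 0.

record Config (n Δ : ℕ) : Set where
  constructor cfg
  field
    adj     : Adj n
    col     : Fin n → Fin (suc Δ)       -- colours 1..Δ+1 as Fin (Δ+1)
    lev     : Fin n → ℕ
    stamp   : Fin n → ℕ                 -- time of last recolouring (0 = never)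
    clock   : ℕ                         -- number of recolourings so far
    pending : Maybe (Fin n)             -- vertex x on which recolor(x) is pending
    cost    : ℕ                         -- running time spent so far
open Config public

module _ {n Δ : ℕ} (c : Config n Δ) where

  -- φ_x(k) for paper level k, given as K = k + 1 (shifted):
  -- number of neighbours u of x with ℓ(u) < k, i.e. lev u < K
  φ : Fin n → ℕ → ℕ
  φ x K = count (λ u → adj c x u ∧ (lev c u <ᵇ K))

  -- the test φ_x(ℓ'+1) < 3^(ℓ'+2) at paper level ℓ' = s - 1 (s shifted)
  LowOK : Fin n → ℕ → Set
  LowOK x s = φ x (suc s) < 3 ^ suc s

  Blank : Fin n → Fin (suc Δ) → Set
  Blank x k = ∀ u → adj c x u ≡ true → col c u ≢ k

  Unique : Fin n → Fin (suc Δ) → Set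
  Unique x k =
    (∀ u → adj c x u ≡ true → lev c x ≤ lev c u → col c u ≢ k) ×
    count (λ u → adj c x u ∧ (lev c u <ᵇ lev c x) ∧ (col c u == k)) ≡ 1

IsNewLevel : ∀ {n Δ} → Config n Δ → Fin n → ℕ → ℕ → Set
IsNewLevel c x s s' =
  s < s' × LowOK c x s' × (∀ k → s < k → k < s' → ¬ LowOK c x k)

-- Small-step semantics. A state is (remaining updates, configuration).
-- Random and "deterministic" choices are modelled by nondeterminism: every
-- admissible choice is a possible step.

State : ℕ → ℕ → Set
State n Δ = List (Update n) × Config n Δ

data Step {n Δ : ℕ} : State n Δ → State n Δ → Set where
  s-del : ∀ {u v us} (c : Config n Δ) → pending c ≡ nothing →
    Step (del u v ∷ us , c)
         (us , record c { adj = delEdge (adj c) u v ; cost = suc (cost c) })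
  s-ins-ok : ∀ {u v us} (c : Config n Δ) → pending c ≡ nothing →
    col c u ≢ col c v →
    Step (ins u v ∷ us , c)
         (us , record c { adj = addEdge (adj c) u v ; cost = suc (cost c) })
  -- insertion with χ(u) = χ(v): start recolouring the endpoint x that was
  -- recoloured most recently (ties broken arbitrarily)
  s-ins-conf : ∀ {u v us} (c : Config n Δ) (x : Fin n) → pending c ≡ nothing →
    col c u ≡ col c v →
    ((x ≡ u × stamp c v ≤ stamp c u) ⊎ (x ≡ v × stamp c u ≤ stamp c v)) →
    Step (ins u v ∷ us , c)
         (us , record c { adj = addEdge (adj c) u v ; cost = suc (cost c)
                        ; pending = just x })
  -- recolor(x) → det-color(x): cost 3^ℓ(x) (here 3^(ℓ(x)+1), same up to ×3)
  s-det : ∀ {us} (c : Config n Δ) (x : Fin n) (k : Fin (suc Δ)) →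
    pending c ≡ just x → LowOK c x (lev c x) → Blank c x k →
    Step (us , c)
         (us , record c { col = update (col c) x k ; lev = update (lev c) x 0
                        ; stamp = update (stamp c) x (suc (clock c))
                        ; clock = suc (clock c) ; pending = nothing
                        ; cost = cost c + 3 ^ lev c x })
  s-rand-blank : ∀ {us} (c : Config n Δ) (x : Fin n) (s' : ℕ) (k : Fin (suc Δ)) →
    pending c ≡ just x → ¬ LowOK c x (lev c x) → IsNewLevel c x (lev c x) s' →
    Blank (record c { lev = update (lev c) x s' }) x k →
    Step (us , c)
         (us , record c { col = update (col c) x k ; lev = update (lev c) x s'
                        ; stamp = update (stamp c) x (suc (clock c))
                        ; clock = suc (clock c) ; pending = nothing
                        ; cost = cost c + 3 ^ s' })
  -- recolor(x) → rand-color(x), chosen colour unique: continue with the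
  -- unique down-neighbour y having that colour
  s-rand-unique : ∀ {us} (c : Config n Δ) (x : Fin n) (s' : ℕ) (k : Fin (suc Δ))
    (y : Fin n) →
    pending c ≡ just x → ¬ LowOK c x (lev c x) → IsNewLevel c x (lev c x) s' →
    Unique (record c { lev = update (lev c) x s' }) x k →
    adj c x y ≡ true → lev c y < s' → col c y ≡ k →
    Step (us , c)
         (us , record c { col = update (col c) x k ; lev = update (lev c) x s'
                        ; stamp = update (stamp c) x (suc (clock c))
                        ; clock = suc (clock c) ; pending = just y
                        ; cost = cost c + 3 ^ s' })

-- initial state: empty graph, arbitrary colouring, all levels -1, cost equal
-- to the preprocessing time n log n + Δ n
initConfig : ∀ {n Δ} → (Fin n → Fin (suc Δ)) → Config n Δ
initConfig {n} {Δ} χ₀ =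
  cfg emptyG χ₀ (λ _ → 0) (λ _ → 0) 0 nothing (n * ⌈log₂ n ⌉ + Δ * n)

Reachable : ∀ {n Δ} → State n Δ → State n Δ → Set
Reachable = Star Step

-- The proof is an amortised analysis with the potential Φ = Σ_v lev v.
--   * Each remaining update carries a prepaid credit K = 1 + M and a pending
--     recolouring chain carries a credit M, where M = n + n².
--   * A rand-color step moves x to a strictly higher level s' with
--     3^s' ≤ φ_x(s') ≤ n, so its cost 3^s' is paid by the rise of n · Φ.
--   * A det-color step costs 3^ℓ ≤ n and lowers n · Φ by n · ℓ ≤ n²; both are
--     paid from the chain credit M, which it consumes.
-- Hence cost + credits ≤ preprocessing + t K + n Φ is invariant.  Finally only
-- vertices touched by some update ever leave level 0 and every level is at
-- most n, so Φ ≤ 2 t n, giving cost ≤ P + t K + 2 t n², which is ≤ 5 (t n² + P).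
module Submission where

open import Defs
open import Data.Nat
open import Data.Nat.Properties
open import Data.Nat.Logarithm using (⌈log₂_⌉)
open import Data.Nat.Tactic.RingSolver using (solve-∀)
open import Data.Bool using (Bool; true; false; T?; _∧_; _∨_)
open import Data.Fin using (Fin; zero; suc)
import Data.Fin as Fin
open import Data.List using (List; []; _∷_; length; allFin)
open import Data.List.Properties using (length-tabulate; length-filter)
open import Data.List.Membership.Propositional using (_∈_)
open import Data.List.Relation.Unary.Any using (here; there)
open import Data.List.Relation.Binary.Subset.Propositional using (_⊆_)
open import Data.Maybe using (Maybe; just; nothing)
open import Data.Product using (_×_; _,_; proj₁; ∃-syntax)
open import Data.Sum using (_⊎_; inj₁; inj₂)
open import Function using (_∘_; id)
open import Relation.Binary.PropositionalEquality
open import Relation.Binary.Construct.Closure.ReflexiveTransitive using (ε; _◅_)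
open import Relation.Nullary using (¬_; yes; no; contradiction)

==-true : ∀ {n} {a b : Fin n} → (a == b) ≡ true → a ≡ b
==-true {a = a} {b} eq with a Fin.≟ b
... | yes a≡b = a≡b

==-false : ∀ {n} {a b : Fin n} → (a == b) ≡ false → a ≢ b
==-false {a = a} {b} eq with a Fin.≟ b
... | no a≢b = a≢b

==-suc : ∀ {n} (a b : Fin n) → (suc a == suc b) ≡ (a == b)
==-suc a b with a Fin.≟ b
... | yes _ = refl
... | no _ = refl

update-preserves : ∀ {n} {A : Set} (P : Fin n → A → Set) (f : Fin n → A) x a →
  (∀ v → P v (f v)) → P x a → ∀ v → P v (update f x a v)
update-preserves P f x a Pf Pa v with v == x in eq
... | true = subst (λ w → P w a) (sym (==-true eq)) Pa
... | false = Pf v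

∑ : ∀ {n} → (Fin n → ℕ) → ℕ
∑ {zero} f = 0
∑ {suc n} f = f zero + ∑ (f ∘ suc)

∑-zero : ∀ {n} (f : Fin n → ℕ) → (∀ v → f v ≡ 0) → ∑ f ≡ 0
∑-zero {zero} f f≡0 = refl
∑-zero {suc n} f f≡0 = cong₂ _+_ (f≡0 zero) (∑-zero (f ∘ suc) (f≡0 ∘ suc))

∑-cong : ∀ {n} {f g : Fin n → ℕ} → (∀ v → f v ≡ g v) → ∑ f ≡ ∑ g
∑-cong {zero} f≗g = refl
∑-cong {suc n} f≗g = cong₂ _+_ (f≗g zero) (∑-cong (f≗g ∘ suc))

∑-update : ∀ {n} (f : Fin n → ℕ) x a → ∑ (update f x a) + f x ≡ ∑ f + a
∑-update {suc n} f zero a = swap-ends a (∑ (f ∘ suc)) (f zero)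
  where
  swap-ends : ∀ p q r → p + q + r ≡ r + q + p
  swap-ends = solve-∀
∑-update {suc n} f (suc x) a = begin
  f zero + ∑ (update f (suc x) a ∘ suc) + f (suc x)
    ≡⟨ cong (λ s → f zero + s + f (suc x)) (∑-cong update-suc) ⟩
  f zero + ∑ (update (f ∘ suc) x a) + f (suc x)
    ≡⟨ +-assoc (f zero) _ _ ⟩
  f zero + (∑ (update (f ∘ suc) x a) + f (suc x))
    ≡⟨ cong (f zero +_) (∑-update (f ∘ suc) x a) ⟩
  f zero + (∑ (f ∘ suc) + a)
    ≡⟨ +-assoc (f zero) _ _ ⟨
  f zero + ∑ (f ∘ suc) + a ∎
  where
  open ≡-Reasoning
  update-suc : ∀ i → update f (suc x) a (suc i) ≡ update (f ∘ suc) x a i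
  update-suc i rewrite ==-suc i x = refl

∑-bounded-support : ∀ {n} (f : Fin n → ℕ) (B : ℕ) (L : List (Fin n)) →
  (∀ v → f v ≤ B) → (∀ v → 0 < f v → v ∈ L) → ∑ f ≤ length L * B
∑-bounded-support f B [] f≤B supp = ≤-reflexive (∑-zero f vanish)
  where
  vanish : ∀ v → f v ≡ 0
  vanish v = n≤0⇒n≡0 (≮⇒≥ (λ pos → ∉[] (supp v pos)))
    where
    ∉[] : ∀ {w : Fin _} → ¬ w ∈ []
    ∉[] ()
∑-bounded-support f B (x ∷ L) f≤B supp = begin
  ∑ f                     ≤⟨ m≤m+n (∑ f) 0 ⟩
  ∑ f + 0                 ≡⟨ ∑-update f x 0 ⟨
  ∑ (update f x 0) + f x  ≤⟨ +-mono-≤ (∑-bounded-support (update f x 0) B L g≤B g-supp) (f≤B x) ⟩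
  length L * B + B        ≡⟨ +-comm (length L * B) B ⟩
  suc (length L) * B      ∎
  where
  open ≤-Reasoning
  g≤B : ∀ v → update f x 0 v ≤ B
  g≤B = update-preserves (λ _ b → b ≤ B) f x 0 f≤B z≤n
  g-supp : ∀ v → 0 < update f x 0 v → v ∈ L
  g-supp v pos with v == x in eq
  ... | true = contradiction pos (λ ())
  ... | false with supp v pos
  ...   | here v≡x = contradiction v≡x (==-false eq)
  ...   | there v∈L = v∈L

count≤n : ∀ {n} (p : Fin n → Bool) → count p ≤ n
count≤n {n} p = ≤-trans (length-filter (T? ∘ p) (allFin n)) (≤-reflexive (length-tabulate id))

m<3^m : ∀ m → m < 3 ^ m
m<3^m zero = z<s
m<3^m (suc m) = ≤-<-trans (m<3^m m) (^-monoʳ-< 3 (s≤s (s≤s z≤n)) (n<1+n m))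

-- rand-color moves x to the least level s' above ℓ(x) that passes the test;
-- the test fails just below s', so 3^s' ≤ φ_x(s') ≤ n.
new-level-small : ∀ {n Δ} (c : Config n Δ) x s' → ¬ LowOK c x (lev c x) →
  IsNewLevel c x (lev c x) s' → 3 ^ s' ≤ n
new-level-small c x zero high (() , _)
new-level-small c x (suc k) high (ℓ<s' , _ , minimal) = ≤-trans (≮⇒≥ not-low) (count≤n _)
  where
  not-low : ¬ LowOK c x k
  not-low with m≤n⇒m<n∨m≡n (≤-pred ℓ<s')
  ... | inj₁ ℓ<k = minimal k ℓ<k (n<1+n k)
  ... | inj₂ refl = high

level≤n : ∀ {n} ℓ → 3 ^ ℓ ≤ n → ℓ ≤ n
level≤n ℓ small = <⇒≤ (<-≤-trans (m<3^m ℓ) small)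

vertex⇒1≤n : ∀ {n} → Fin n → 1 ≤ n
vertex⇒1≤n zero = s≤s z≤n
vertex⇒1≤n (suc _) = s≤s z≤n

touched : ∀ {n} → List (Update n) → List (Fin n)
touched [] = []
touched (ins u v ∷ us) = u ∷ v ∷ touched us
touched (del u v ∷ us) = u ∷ v ∷ touched us

length-touched : ∀ {n} (us : List (Update n)) → length (touched us) ≡ length us * 2
length-touched [] = refl
length-touched (ins _ _ ∷ us) = cong (2 +_) (length-touched us)
length-touched (del _ _ ∷ us) = cong (2 +_) (length-touched us)

-- A nonempty update sequence mentions a vertex, so then n ≥ 1.
length≤length*n : ∀ {n} (us : List (Update n)) → length us ≤ length us * n
length≤length*n [] = z≤n
length≤length*n {zero} (ins () _ ∷ _)
length≤length*n {zero} (del () _ ∷ _)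
length≤length*n {suc n} us@(_ ∷ _) = m≤m*n (length us) (suc n)

∧-true-left : ∀ {a b : Bool} → (a ∧ b) ≡ true → a ≡ true
∧-true-left {true} _ = refl

∧-true-right : ∀ {a b : Bool} → (a ∧ b) ≡ true → b ≡ true
∧-true-right {true} e = e

∨-true : ∀ {a b : Bool} → (a ∨ b) ≡ true → a ≡ true ⊎ b ≡ true
∨-true {true} _ = inj₁ refl
∨-true {false} e = inj₂ e

addEdge-target : ∀ {n} (g : Adj n) u v a b → addEdge g u v a b ≡ true →
  g a b ≡ true ⊎ (b ≡ v ⊎ b ≡ u)
addEdge-target g u v a b e with ∨-true {g a b} e
... | inj₁ old = inj₁ old
... | inj₂ new with ∨-true {a == u ∧ b == v} new
...   | inj₁ b≡v = inj₂ (inj₁ (==-true (∧-true-right b≡v)))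
...   | inj₂ b≡u = inj₂ (inj₂ (==-true (∧-true-right b≡u)))

-- Arithmetic of a single step.  Below a is the cost so far, R the credit
-- of the remaining updates, and n · Φ, n · Φ' the potential before and after.

-- A constant-time update spends 1 of its prepaid credit 1 + M.
update-paid : ∀ a M R X → suc a + 0 + R + X ≤ a + 0 + suc (M + R) + X
update-paid a M R X = ≤-trans (m≤n+m _ M) (≤-reflexive (reorder a M R X))
  where
  reorder : ∀ a M R X → M + (suc a + 0 + R + X) ≡ a + 0 + suc (M + R) + X
  reorder = solve-∀

-- A conflicting insertion turns its prepaid credit 1 + M into 1 unit of
-- work and the credit M of the recolouring chain it starts.
conflict-paid : ∀ a M R X → suc a + M + R + X ≡ a + 0 + suc (M + R) + X
conflict-paid = solve-∀

-- det-color lowers ℓ(x) from e to 0: its cost 3^e and the potential loss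
-- n · e are paid from the chain credit M.
det-paid : ∀ n M a e R Φ Φ' → Φ' + e ≡ Φ + 0 → 3 ^ e + n * e ≤ M →
  a + 3 ^ e + 0 + R + n * Φ ≤ a + M + R + n * Φ'
det-paid n M a e R Φ Φ' drop within = begin
  a + 3 ^ e + 0 + R + n * Φ         ≡⟨ cong (λ z → a + 3 ^ e + 0 + R + n * z) Φ≡Φ'+e ⟩
  a + 3 ^ e + 0 + R + n * (Φ' + e)  ≡⟨ regroup a (3 ^ e) R n Φ' e ⟩
  a + (3 ^ e + n * e) + R + n * Φ'  ≤⟨ +-monoˡ-≤ (n * Φ') (+-monoˡ-≤ R (+-monoʳ-≤ a within)) ⟩
  a + M + R + n * Φ'                ∎
  where
  open ≤-Reasoning
  Φ≡Φ'+e : Φ ≡ Φ' + e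
  Φ≡Φ'+e = trans (sym (+-identityʳ Φ)) (sym drop)
  regroup : ∀ a b R n Φ' e → a + b + 0 + R + n * (Φ' + e) ≡ a + (b + n * e) + R + n * Φ'
  regroup = solve-∀

potential-rises : ∀ Φ Φ' e s → Φ' + e ≡ Φ + s → e < s → suc Φ ≤ Φ'
potential-rises Φ Φ' e s rise e<s = +-cancelʳ-≤ e (suc Φ) Φ' (begin
  suc Φ + e  ≡⟨ +-suc Φ e ⟨
  Φ + suc e  ≤⟨ +-monoʳ-≤ Φ e<s ⟩
  Φ + s      ≡⟨ rise ⟨
  Φ' + e     ∎)
  where open ≤-Reasoning

-- rand-color costs 3^s ≤ n, paid by the rise of the potential by ≥ n;
-- the chain credit M is kept or released (p ≤ M).
rand-paid : ∀ n M a s p R Φ Φ' → p ≤ M → 3 ^ s ≤ n → suc Φ ≤ Φ' →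
  a + 3 ^ s + p + R + n * Φ ≤ a + M + R + n * Φ'
rand-paid n M a s p R Φ Φ' p≤M small rises = begin
  a + 3 ^ s + p + R + n * Φ    ≤⟨ +-monoˡ-≤ (n * Φ) (+-monoˡ-≤ R (+-monoʳ-≤ (a + 3 ^ s) p≤M)) ⟩
  a + 3 ^ s + M + R + n * Φ    ≡⟨ regroup a (3 ^ s) M R (n * Φ) ⟩
  a + M + R + (3 ^ s + n * Φ)  ≤⟨ +-monoʳ-≤ (a + M + R) (+-monoˡ-≤ (n * Φ) small) ⟩
  a + M + R + (n + n * Φ)      ≡⟨ cong (a + M + R +_) (*-suc n Φ) ⟨
  a + M + R + n * suc Φ        ≤⟨ +-monoʳ-≤ (a + M + R) (*-monoʳ-≤ n rises) ⟩
  a + M + R + n * Φ'           ∎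
  where
  open ≤-Reasoning
  regroup : ∀ a b M R X → a + b + M + R + X ≡ a + M + R + (b + X)
  regroup = solve-∀

budget-step : ∀ Ψ Ψ' X X' B → Ψ' + X ≤ Ψ + X' → Ψ ≤ B + X → Ψ' ≤ B + X'
budget-step Ψ Ψ' X X' B amortised bound = +-cancelʳ-≤ X Ψ' (B + X') (begin
  Ψ' + X        ≤⟨ amortised ⟩
  Ψ + X'        ≤⟨ +-monoˡ-≤ X' bound ⟩
  B + X + X'    ≡⟨ swap B X X' ⟩
  B + X' + X    ∎)
  where
  open ≤-Reasoning
  swap : ∀ B X X' → B + X + X' ≡ B + X' + X
  swap = solve-∀

final-arithmetic : ∀ t n L D → t ≤ t * n →
  L + D + t * suc (n + n * n) + n * (t * 2 * n) ≤ 5 * (t * n ^ 2 + L + D)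
final-arithmetic t n L D t≤tn = begin
  L + D + t * suc (n + n * n) + n * (t * 2 * n)   ≡⟨ expand t n L D ⟩
  L + D + (t + t * n + 3 * (t * n * n))           ≤⟨ +-monoʳ-≤ (L + D) (+-monoˡ-≤ (3 * (t * n * n)) (+-mono-≤ t≤tnn tn≤tnn)) ⟩
  L + D + (t * n * n + t * n * n + 3 * (t * n * n)) ≡⟨ collect t n L D ⟩
  5 * (t * n ^ 2) + (L + D)                       ≤⟨ +-monoʳ-≤ (5 * (t * n ^ 2)) (m≤n*m (L + D) 5) ⟩
  5 * (t * n ^ 2) + 5 * (L + D)                   ≡⟨ factor (t * n ^ 2) L D ⟩
  5 * (t * n ^ 2 + L + D)                         ∎
  where
  open ≤-Reasoning
  tn≤tnn : t * n ≤ t * n * n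
  tn≤tnn = *-monoˡ-≤ n t≤tn
  t≤tnn : t ≤ t * n * n
  t≤tnn = ≤-trans t≤tn tn≤tnn
  expand : ∀ t n L D → L + D + t * suc (n + n * n) + n * (t * 2 * n) ≡ L + D + (t + t * n + 3 * (t * n * n))
  expand = solve-∀
  -- n ^ 2 unfolds to n * (n * 1), the form the ring solver accepts
  collect : ∀ t n L D → L + D + (t * n * n + t * n * n + 3 * (t * n * n)) ≡ 5 * (t * (n * (n * 1))) + (L + D)
  collect = solve-∀
  factor : ∀ X L D → 5 * X + 5 * (L + D) ≡ 5 * (X + L + D)
  factor = solve-∀

chainCredit : ℕ → ℕ
chainCredit n = n + n * n

module Accounting {n Δ : ℕ} where

  credit : Maybe (Fin n) → ℕ
  credit nothing = 0
  credit (just _) = chainCredit n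

  Φ : Config n Δ → ℕ
  Φ c = ∑ (lev c)

  Ψ : List (Update n) → Config n Δ → ℕ
  Ψ l c = cost c + credit (pending c) + length l * suc (chainCredit n)

  det-within-credit : ∀ e → 3 ^ e ≤ n → 3 ^ e + n * e ≤ chainCredit n
  det-within-credit e small = +-mono-≤ small (*-monoʳ-≤ n (level≤n e small))

  amortised : ∀ {l c l' c'} → (∀ v → 3 ^ lev c v ≤ n) → Step (l , c) (l' , c') →
    Ψ l' c' + n * Φ c ≤ Ψ l c + n * Φ c'
  amortised _ (s-del c idle) rewrite idle =
    update-paid (cost c) (chainCredit n) _ _
  amortised _ (s-ins-ok c idle _) rewrite idle =
    update-paid (cost c) (chainCredit n) _ _
  amortised _ (s-ins-conf c x idle _ _) rewrite idle =
    ≤-reflexive (conflict-paid (cost c) (chainCredit n) _ _)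
  amortised small (s-det c x k busy _ _) rewrite busy =
    det-paid n (chainCredit n) (cost c) (lev c x) _ (Φ c) _
      (∑-update (lev c) x 0) (det-within-credit (lev c x) (small x))
  amortised _ (s-rand-blank c x s' k busy high new _) rewrite busy =
    rand-paid n (chainCredit n) (cost c) s' 0 _ (Φ c) _ z≤n
      (new-level-small c x s' high new)
      (potential-rises (Φ c) _ (lev c x) s' (∑-update (lev c) x s') (proj₁ new))
  amortised _ (s-rand-unique c x s' k y busy high new _ _ _ _) rewrite busy =
    rand-paid n (chainCredit n) (cost c) s' (chainCredit n) _ (Φ c) _ ≤-refl
      (new-level-small c x s' high new)
      (potential-rises (Φ c) _ (lev c x) s' (∑-update (lev c) x s') (proj₁ new))

  record Shape (E : List (Fin n)) (l : List (Update n)) (c : Config n Δ) : Set where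
    field
      levels-small    : ∀ v → 3 ^ lev c v ≤ n
      edges-touched   : ∀ a b → adj c a b ≡ true → b ∈ E
      levels-touched  : ∀ v → 0 < lev c v → v ∈ E
      pending-touched : ∀ x → pending c ≡ just x → x ∈ E
      updates-touched : touched l ⊆ E
  open Shape

  inserted-edges : ∀ {E u v l c} → Shape E (ins u v ∷ l) c →
    ∀ a b → addEdge (adj c) u v a b ≡ true → b ∈ E
  inserted-edges {c = c} S a b e with addEdge-target (adj c) _ _ a b e
  ... | inj₁ old = edges-touched S a b old
  ... | inj₂ (inj₁ refl) = updates-touched S (there (here refl))
  ... | inj₂ (inj₂ refl) = updates-touched S (here refl)

  -- Updates consume two touched endpoints and leave levels alone;
  -- recolourings leave the graph alone and only move a pending vertex.
  shape-step : ∀ {E l c l' c'} → Shape E l c → Step (l , c) (l' , c') → Shape E l' c'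
  shape-step S (s-del c idle) = record
    { levels-small = levels-small S
    ; edges-touched = λ a b e → edges-touched S a b (∧-true-left e)
    ; levels-touched = levels-touched S
    ; pending-touched = pending-touched S
    ; updates-touched = updates-touched S ∘ there ∘ there }
  shape-step S (s-ins-ok c idle _) = record
    { levels-small = levels-small S
    ; edges-touched = inserted-edges S
    ; levels-touched = levels-touched S
    ; pending-touched = pending-touched S
    ; updates-touched = updates-touched S ∘ there ∘ there }
  shape-step S (s-ins-conf c x idle _ endpoint) = record
    { levels-small = levels-small S
    ; edges-touched = inserted-edges S
    ; levels-touched = levels-touched S
    ; pending-touched = λ { _ refl → endpoint-touched endpoint }
    ; updates-touched = updates-touched S ∘ there ∘ there }
    where
    endpoint-touched : ∀ {A B : Set} → (x ≡ _ × A) ⊎ (x ≡ _ × B) → x ∈ _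
    endpoint-touched (inj₁ (refl , _)) = updates-touched S (here refl)
    endpoint-touched (inj₂ (refl , _)) = updates-touched S (there (here refl))
  shape-step S (s-det c x k busy _ _) = record
    { levels-small = update-preserves (λ _ ℓ → 3 ^ ℓ ≤ n) (lev c) x 0
        (levels-small S) (vertex⇒1≤n x)
    ; edges-touched = edges-touched S
    ; levels-touched = update-preserves (λ v ℓ → 0 < ℓ → v ∈ _) (lev c) x 0
        (levels-touched S) (λ ())
    ; pending-touched = λ _ ()
    ; updates-touched = updates-touched S }
  shape-step S (s-rand-blank c x s' k busy high new _) = record
    { levels-small = update-preserves (λ _ ℓ → 3 ^ ℓ ≤ n) (lev c) x s'
        (levels-small S) (new-level-small c x s' high new)
    ; edges-touched = edges-touched S
    ; levels-touched = update-preserves (λ v ℓ → 0 < ℓ → v ∈ _) (lev c) x s'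
        (levels-touched S) (λ _ → pending-touched S x busy)
    ; pending-touched = λ _ ()
    ; updates-touched = updates-touched S }
  shape-step S (s-rand-unique c x s' k y busy high new _ x~y _ _) = record
    { levels-small = update-preserves (λ _ ℓ → 3 ^ ℓ ≤ n) (lev c) x s'
        (levels-small S) (new-level-small c x s' high new)
    ; edges-touched = edges-touched S
    ; levels-touched = update-preserves (λ v ℓ → 0 < ℓ → v ∈ _) (lev c) x s'
        (levels-touched S) (λ _ → pending-touched S x busy)
    ; pending-touched = λ { _ refl → edges-touched S x y x~y }
    ; updates-touched = updates-touched S }

  budget : List (Update n) → ℕ
  budget us = n * ⌈log₂ n ⌉ + Δ * n + length us * suc (chainCredit n)

  Invariant : List (Update n) → State n Δ → Set
  Invariant us (l , c) = Shape (touched us) l c × Ψ l c ≤ budget us + n * Φ c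

  initial-invariant : ∀ us χ₀ → Invariant us (us , initConfig χ₀)
  initial-invariant us χ₀ =
    record
      { levels-small = vertex⇒1≤n
      ; edges-touched = λ _ _ ()
      ; levels-touched = λ _ ()
      ; pending-touched = λ _ ()
      ; updates-touched = id }
    , ≤-trans (≤-reflexive (cong (_+ length us * suc (chainCredit n)) (+-identityʳ _)))
        (m≤m+n (budget us) _)

  invariant-step : ∀ {us s s'} → Invariant us s → Step s s' → Invariant us s'
  invariant-step (S , within) step =
    shape-step S step , budget-step _ _ _ _ _ (amortised (levels-small S) step) within

  invariant-run : ∀ {us s s'} → Invariant us s → Reachable s s' → Invariant us s'
  invariant-run I ε = I
  invariant-run I (step ◅ run) = invariant-run (invariant-step I step) run

  -- Only the 2t touched vertices have positive level, each at most n.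
  potential-bound : ∀ {us l c} → Shape (touched us) l c → Φ c ≤ length us * 2 * n
  potential-bound {us} {c = c} S =
    subst (λ m → Φ c ≤ m * n) (length-touched us)
      (∑-bounded-support (lev c) n (touched us)
        (λ v → level≤n (lev c v) (levels-small S v)) (levels-touched S))

  reachable-cost-bound : ∀ us χ₀ {l c} → Reachable (us , initConfig χ₀) (l , c) →
    cost c ≤ budget us + n * (length us * 2 * n)
  reachable-cost-bound us χ₀ run with invariant-run (initial-invariant us χ₀) run
  ... | S , within =
    ≤-trans (≤-trans (m≤m+n _ _) (m≤m+n _ _))
      (≤-trans within (+-monoʳ-≤ (budget us) (*-monoʳ-≤ n (potential-bound S))))

lemma14 : ∃[ C ] (∀ (n Δ : ℕ) → 0 < Δ → (χ₀ : Fin n → Fin (suc Δ)) →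
    (us : List (Update n)) → Valid Δ emptyG us →
    (rest : List (Update n)) (c : Config n Δ) →
    Reachable (us , initConfig χ₀) (rest , c) →
    cost c ≤ C * (length us * n ^ 2 + n * ⌈log₂ n ⌉ + Δ * n))
lemma14 = 5 , λ n Δ _ χ₀ us _ rest c run →
  ≤-trans (Accounting.reachable-cost-bound us χ₀ run)
    (final-arithmetic (length us) n _ _ (length≤length*n us))
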